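{- Let $G$ be a 2-connected bipartite graph and $H$ a 2-connected subgraph of $G$. If $H$ has an odd ear in $G$, then every vertex of $G$ belongs to an odd theta subgraph of $G$.
   Context: Graphs are finite, may have parallel edges but no loops. A path is a circuit (connected 2-regular graph) minus an edge; it is odd if it has an odd number of edges. An ear of $H$ in $G$ is a path of $G$ having exactly its two distinct ends in $H$. Two paths are inner-disjoint if they share no vertices other than their ends. An odd theta is a graph formed by three inner-disjoint odd paths with the same two ends (each path may be a single edge). -}

module Defs where

open import Data.Nat using (ℕ; zero; suc; _*_)
open import Data.Fin using (Fin; zero; suc; inject₁; fromℕ)
open import Data.Product using (Σ; ∃; ∃-syntax; _×_; _,_; proj₁; proj₂)
open import Data.Sum using (_⊎_)
open import Data.Bool using (Bool)
open import Data.Unit using (⊤)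
open import Relation.Nullary using (¬_)
open import Relation.Binary.PropositionalEquality using (_≡_; _≢_)
open import Function.Definitions using (Injective)

Odd : ℕ → Set
Odd k = ∃[ j ] k ≡ suc (2 * j)

record Graph : Set where
  field
    nV : ℕ
    nE : ℕ
    ends : Fin nE → Fin nV × Fin nV
    loopless : ∀ e → proj₁ (ends e) ≢ proj₂ (ends e)

module _ (G : Graph) where
  open Graph G

  Vertex : Set
  Vertex = Fin nV

  Edge : Set
  Edge = Fin nE

  src tgt : Edge → Vertex
  src e = proj₁ (ends e)
  tgt e = proj₂ (ends e)

  Joins : Edge → Vertex → Vertex → Set
  Joins e x y = (src e ≡ x × tgt e ≡ y) ⊎ (src e ≡ y × tgt e ≡ x)

  Incident : Edge → Vertex → Set
  Incident e x = src e ≡ x ⊎ tgt e ≡ x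

  Bipartite : Set
  Bipartite = Σ (Vertex → Bool) λ c → ∀ e → c (src e) ≢ c (tgt e)

  record Subgraph : Set₁ where
    field
      V : Vertex → Set
      E : Edge → Set
      closed : ∀ e → E e → V (src e) × V (tgt e)

  whole : Subgraph
  whole = record { V = λ _ → ⊤ ; E = λ _ → ⊤ ; closed = λ _ _ → _ , _ }

  data Walk (F : Edge → Set) : Vertex → Vertex → Set where
    nil  : ∀ {x} → Walk F x x
    cons : ∀ {x y z} (e : Edge) → F e → Joins e x y → Walk F y z → Walk F x z

  -- 2-connected (Diestel): at least 3 vertices, connected, and
  -- removing any single vertex leaves a connected graph.
  TwoConnected : Subgraph → Set
  TwoConnected H =
    (∃[ a ] ∃[ b ] ∃[ c ] (V a × V b × V c × a ≢ b × a ≢ c × b ≢ c))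
    × (∀ a b → V a → V b → Walk E a b)
    × (∀ x a b → V a → V b → a ≢ x → b ≢ x →
         Walk (λ e → E e × ¬ Incident e x) a b)
    where open Subgraph H

  -- A path with suc len edges: distinct vertices vtx 0 .. vtx (suc len),
  -- consecutive ones joined by edge i.
  record Path : Set where
    field
      len : ℕ
      vtx : Fin (suc (suc len)) → Vertex
      vtx-inj : Injective _≡_ _≡_ vtx
      edge : Fin (suc len) → Edge
      joins : ∀ i → Joins (edge i) (vtx (inject₁ i)) (vtx (suc i))

    numEdges : ℕ
    numEdges = suc len

    start end : Vertex
    start = vtx zero
    end = vtx (fromℕ (suc len))

    OnPath : Vertex → Set
    OnPath w = ∃[ i ] vtx i ≡ w

    Inner : Vertex → Set
    Inner w = OnPath w × w ≢ start × w ≢ end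

  OddPath : Path → Set
  OddPath P = Odd (Path.numEdges P)

  Ear : Subgraph → Path → Set
  Ear H P =
    V start × V end × start ≢ end
    × (∀ w → Inner w → ¬ V w)
    × (∀ i → ¬ E (edge i))
    where open Subgraph H
          open Path P

  InnerDisjoint : Path → Path → Set
  InnerDisjoint P Q = ∀ w → Path.OnPath P w → Path.OnPath Q w →
    (w ≡ Path.start P ⊎ w ≡ Path.end P)

  EdgeDisjoint : Path → Path → Set
  EdgeDisjoint P Q = ∀ i j → Path.edge P i ≢ Path.edge Q j

  -- Three inner-disjoint odd paths between the same two ends u and v
  -- (pairwise distinct as edge sets, so parallel single edges are distinct).
  record OddTheta : Set where
    field
      u v : Vertex
      P₁ P₂ P₃ : Path
      s₁ : Path.start P₁ ≡ u
      s₂ : Path.start P₂ ≡ u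
      s₃ : Path.start P₃ ≡ u
      e₁ : Path.end P₁ ≡ v
      e₂ : Path.end P₂ ≡ v
      e₃ : Path.end P₃ ≡ v
      odd₁ : OddPath P₁
      odd₂ : OddPath P₂
      odd₃ : OddPath P₃
      id₁₂ : InnerDisjoint P₁ P₂
      id₁₃ : InnerDisjoint P₁ P₃
      id₂₃ : InnerDisjoint P₂ P₃
      ed₁₂ : EdgeDisjoint P₁ P₂
      ed₁₃ : EdgeDisjoint P₁ P₃
      ed₂₃ : EdgeDisjoint P₂ P₃

  InTheta : OddTheta → Vertex → Set
  InTheta T w = Path.OnPath P₁ w ⊎ Path.OnPath P₂ w ⊎ Path.OnPath P₃ w
    where open OddTheta T

-- A proper 2-colouring alternates along walks, so a theta whose branch vertices u and v have
-- different colours is an odd theta, and the ends of the odd ear P have different colours.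
-- Together with two internally disjoint paths of H between these ends (grown edge by edge along
-- a path of H, using 2-connectivity of H) P forms a first such theta. Such a theta absorbs every
-- ear Q: if both ends of Q lie on one of its paths, Q replaces the segment between them;
-- otherwise Q, two segments and the third path form a theta with one branch vertex moved to an
-- end of Q, chosen so that the colours still differ. Finally, a vertex w is joined to the theta
-- by a path R; 2-connectivity of G gives a detour from R to the theta avoiding the end of R,
-- which yields an ear whose addition leaves a shorter such path from w.

module Submission where

open import Defs
open import Data.Bool using (Bool; not)
open import Data.Bool.Properties using (¬-not; not-¬) renaming (_≟_ to _≟ᵇ_)
open import Data.Empty using (⊥; ⊥-elim)
open import Data.Fin using (Fin; zero; suc; inject₁; fromℕ)
open import Data.Fin.Properties using (suc-injective; 0≢1+n; any?) renaming (_≟_ to _≟ᶠ_)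
open import Data.Nat using (ℕ; zero; suc; _+_; _*_; _≤_; z≤n; s≤s)
open import Data.Nat.Properties using (≤-refl; ≤-trans; ≤-pred; m≤n⇒m≤1+n; +-comm; *-suc; even≢odd)
open import Data.Product using (Σ; ∃-syntax; _×_; _,_; proj₁; proj₂)
open import Data.Sum using (_⊎_; inj₁; inj₂; [_,_]′)
open import Data.Unit using (⊤; tt)
open import Data.Vec.Functional using (Vector; updateAt; _∷_; [])
open import Data.Vec.Functional.Properties using (updateAt-updates; updateAt-minimal)
open import Function using (id; _∘_; const)
open import Function.Definitions using (Injective)
open import Relation.Binary.Definitions using (Symmetric)
open import Relation.Binary.PropositionalEquality using (_≡_; _≢_; refl; sym; trans; cong; subst; subst₂)
open import Relation.Nullary using (¬_; Dec; yes; no)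
open import Relation.Nullary.Decidable using (_⊎-dec_)

module Edges (G : Graph) where

  private variable
    e : Edge G
    x y t : Vertex G

  Joins-sym : Joins G e x y → Joins G e y x
  Joins-sym (inj₁ p) = inj₂ p
  Joins-sym (inj₂ p) = inj₁ p

  Joins⇒≢ : Joins G e x y → x ≢ y
  Joins⇒≢ {e} (inj₁ (s , t)) refl = Graph.loopless G e (trans s (sym t))
  Joins⇒≢ {e} (inj₂ (s , t)) refl = Graph.loopless G e (trans s (sym t))

  Joins⇒Incidentˡ : Joins G e x y → Incident G e x
  Joins⇒Incidentˡ (inj₁ (s , _)) = inj₁ s
  Joins⇒Incidentˡ (inj₂ (_ , t)) = inj₂ t

  Joins⇒Incidentʳ : Joins G e x y → Incident G e y
  Joins⇒Incidentʳ = Joins⇒Incidentˡ ∘ Joins-sym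

  Incident⇒end : Joins G e x y → Incident G e t → t ≡ x ⊎ t ≡ y
  Incident⇒end (inj₁ (s , _)) (inj₁ q) = inj₁ (trans (sym q) s)
  Incident⇒end (inj₁ (_ , t)) (inj₂ q) = inj₂ (trans (sym q) t)
  Incident⇒end (inj₂ (s , _)) (inj₁ q) = inj₂ (trans (sym q) s)
  Incident⇒end (inj₂ (_ , t)) (inj₂ q) = inj₁ (trans (sym q) t)

module Walks (G : Graph) where

  open Edges G

  private variable
    x y z t : Vertex G
    f : Edge G

  infixr 5 _++_
  infix 4 _∈ᵥ_ _∉ᵥ_ _∈ₑ_

  data Walk′ : Vertex G → Vertex G → Set where
    nil  : ∀ {x} → Walk′ x x
    cons : ∀ {x y z} (e : Edge G) → Joins G e x y → Walk′ y z → Walk′ x z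

  _∈ᵥ_ : Vertex G → Walk′ x y → Set
  t ∈ᵥ nil {x} = t ≡ x
  t ∈ᵥ cons {x} _ _ w = t ≡ x ⊎ t ∈ᵥ w

  _∉ᵥ_ : Vertex G → Walk′ x y → Set
  t ∉ᵥ w = ¬ t ∈ᵥ w

  _∈ₑ_ : Edge G → Walk′ x y → Set
  f ∈ₑ nil = ⊥
  f ∈ₑ cons e _ w = f ≡ e ⊎ f ∈ₑ w

  length : Walk′ x y → ℕ
  length nil = 0
  length (cons _ _ w) = suc (length w)

  start∈ : (w : Walk′ x y) → x ∈ᵥ w
  start∈ nil = refl
  start∈ (cons _ _ _) = inj₁ refl

  end∈ : (w : Walk′ x y) → y ∈ᵥ w
  end∈ nil = refl
  end∈ (cons _ _ w) = inj₂ (end∈ w)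

  _∈ᵥ?_ : (t : Vertex G) (w : Walk′ x y) → Dec (t ∈ᵥ w)
  t ∈ᵥ? nil {x} = t ≟ᶠ x
  t ∈ᵥ? cons {x} _ _ w = (t ≟ᶠ x) ⊎-dec (t ∈ᵥ? w)

  ∈ₑ⇒ends∈ᵥ : (w : Walk′ x y) → f ∈ₑ w → Incident G f t → t ∈ᵥ w
  ∈ₑ⇒ends∈ᵥ (cons _ j w) (inj₁ refl) it with Incident⇒end j it
  ... | inj₁ q = inj₁ q
  ... | inj₂ refl = inj₂ (start∈ w)
  ∈ₑ⇒ends∈ᵥ (cons _ _ w) (inj₂ h) it = inj₂ (∈ₑ⇒ends∈ᵥ w h it)

  length-pos : (w : Walk′ x y) → x ≢ y → 1 ≤ length w
  length-pos nil x≢y = ⊥-elim (x≢y refl)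
  length-pos (cons _ _ _) _ = s≤s z≤n

  _++_ : Walk′ x y → Walk′ y z → Walk′ x z
  nil ++ q = q
  cons e j p ++ q = cons e j (p ++ q)

  ∈ᵥ-++⁺ˡ : (p : Walk′ x y) (q : Walk′ y z) → t ∈ᵥ p → t ∈ᵥ p ++ q
  ∈ᵥ-++⁺ˡ nil q refl = start∈ q
  ∈ᵥ-++⁺ˡ (cons _ _ _) q (inj₁ h) = inj₁ h
  ∈ᵥ-++⁺ˡ (cons _ _ p) q (inj₂ h) = inj₂ (∈ᵥ-++⁺ˡ p q h)

  ∈ᵥ-++⁺ʳ : (p : Walk′ x y) (q : Walk′ y z) → t ∈ᵥ q → t ∈ᵥ p ++ q
  ∈ᵥ-++⁺ʳ nil q h = h
  ∈ᵥ-++⁺ʳ (cons _ _ p) q h = inj₂ (∈ᵥ-++⁺ʳ p q h)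

  ∈ᵥ-++⁻ : (p : Walk′ x y) (q : Walk′ y z) → t ∈ᵥ p ++ q → t ∈ᵥ p ⊎ t ∈ᵥ q
  ∈ᵥ-++⁻ nil q h = inj₂ h
  ∈ᵥ-++⁻ (cons _ _ _) q (inj₁ h) = inj₁ (inj₁ h)
  ∈ᵥ-++⁻ (cons _ _ p) q (inj₂ h) = Data.Sum.map₁ inj₂ (∈ᵥ-++⁻ p q h)

  ∈ₑ-++⁺ˡ : (p : Walk′ x y) (q : Walk′ y z) → f ∈ₑ p → f ∈ₑ p ++ q
  ∈ₑ-++⁺ˡ (cons _ _ _) q (inj₁ h) = inj₁ h
  ∈ₑ-++⁺ˡ (cons _ _ p) q (inj₂ h) = inj₂ (∈ₑ-++⁺ˡ p q h)

  ∈ₑ-++⁺ʳ : (p : Walk′ x y) (q : Walk′ y z) → f ∈ₑ q → f ∈ₑ p ++ q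
  ∈ₑ-++⁺ʳ nil q h = h
  ∈ₑ-++⁺ʳ (cons _ _ p) q h = inj₂ (∈ₑ-++⁺ʳ p q h)

  ∈ₑ-++⁻ : (p : Walk′ x y) (q : Walk′ y z) → f ∈ₑ p ++ q → f ∈ₑ p ⊎ f ∈ₑ q
  ∈ₑ-++⁻ nil q h = inj₂ h
  ∈ₑ-++⁻ (cons _ _ _) q (inj₁ h) = inj₁ (inj₁ h)
  ∈ₑ-++⁻ (cons _ _ p) q (inj₂ h) = Data.Sum.map₁ inj₂ (∈ₑ-++⁻ p q h)

  length-≤-++ˡ : (p : Walk′ x y) (q : Walk′ y z) → length p ≤ length (p ++ q)
  length-≤-++ˡ nil q = z≤n
  length-≤-++ˡ (cons _ _ p) q = s≤s (length-≤-++ˡ p q)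

  length-≤-++ʳ : (p : Walk′ x y) (q : Walk′ y z) → length q ≤ length (p ++ q)
  length-≤-++ʳ nil q = ≤-refl
  length-≤-++ʳ (cons _ _ p) q = m≤n⇒m≤1+n (length-≤-++ʳ p q)

  ++-long : (p : Walk′ x y) (q : Walk′ y z) → 1 ≤ length p → 1 ≤ length q → 2 ≤ length (p ++ q)
  ++-long (cons _ _ p) q _ lq = s≤s (≤-trans lq (length-≤-++ʳ p q))

  length-<-++ : (p : Walk′ x y) (q : Walk′ y z) → 1 ≤ length q → suc (length p) ≤ length (p ++ q)
  length-<-++ nil q lq = lq
  length-<-++ (cons _ _ p) q lq = s≤s (length-<-++ p q lq)

  length-++ : (p : Walk′ x y) (q : Walk′ y z) → length (p ++ q) ≡ length p + length q
  length-++ nil q = refl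
  length-++ (cons _ _ p) q = cong suc (length-++ p q)

  ++-assoc : ∀ {w} (p : Walk′ x y) (q : Walk′ y z) (r : Walk′ z w) → (p ++ q) ++ r ≡ p ++ (q ++ r)
  ++-assoc nil q r = refl
  ++-assoc (cons e j p) q r = cong (cons e j) (++-assoc p q r)

  reverse : Walk′ x y → Walk′ y x
  reverse nil = nil
  reverse (cons e j w) = reverse w ++ cons e (Joins-sym j) nil

  ∈ᵥ-reverse⁺ : (w : Walk′ x y) → t ∈ᵥ w → t ∈ᵥ reverse w
  ∈ᵥ-reverse⁺ nil h = h
  ∈ᵥ-reverse⁺ (cons e j w) (inj₁ h) = ∈ᵥ-++⁺ʳ (reverse w) (cons e (Joins-sym j) nil) (inj₂ h)
  ∈ᵥ-reverse⁺ (cons e j w) (inj₂ h) = ∈ᵥ-++⁺ˡ (reverse w) (cons e (Joins-sym j) nil) (∈ᵥ-reverse⁺ w h)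

  ∈ᵥ-reverse⁻ : (w : Walk′ x y) → t ∈ᵥ reverse w → t ∈ᵥ w
  ∈ᵥ-reverse⁻ nil h = h
  ∈ᵥ-reverse⁻ (cons e j w) h with ∈ᵥ-++⁻ (reverse w) (cons e (Joins-sym j) nil) h
  ... | inj₁ h′ = inj₂ (∈ᵥ-reverse⁻ w h′)
  ... | inj₂ (inj₁ refl) = inj₂ (start∈ w)
  ... | inj₂ (inj₂ h′) = inj₁ h′

  ∈ₑ-reverse⁻ : (w : Walk′ x y) → f ∈ₑ reverse w → f ∈ₑ w
  ∈ₑ-reverse⁻ (cons e j w) h with ∈ₑ-++⁻ (reverse w) (cons e (Joins-sym j) nil) h
  ... | inj₁ h′ = inj₂ (∈ₑ-reverse⁻ w h′)
  ... | inj₂ (inj₁ h′) = inj₁ h′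

  length-reverse : (w : Walk′ x y) → length (reverse w) ≡ length w
  length-reverse nil = refl
  length-reverse (cons e j w) =
    trans (length-++ (reverse w) _) (trans (+-comm (length (reverse w)) 1) (cong suc (length-reverse w)))

  IsPath : Walk′ x y → Set
  IsPath nil = ⊤
  IsPath (cons {x} _ _ w) = x ∉ᵥ w × IsPath w

  MeetAtJunction : Walk′ x y → Walk′ y z → Set
  MeetAtJunction {y = y} p q = ∀ {t} → t ∈ᵥ p → t ∈ᵥ q → t ≡ y

  InnerDisjoint′ : Walk′ x y → Walk′ x y → Set
  InnerDisjoint′ {x} {y} p q = ∀ {t} → t ∈ᵥ p → t ∈ᵥ q → t ≡ x ⊎ t ≡ y

  EdgeDisjoint′ : Walk′ x y → Walk′ x y → Set
  EdgeDisjoint′ p q = ∀ {f} → f ∈ₑ p → f ∈ₑ q → ⊥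

  InnerDisjoint′-sym : Symmetric (InnerDisjoint′ {x} {y})
  InnerDisjoint′-sym d hq hp = d hp hq

  EdgeDisjoint′-sym : Symmetric (EdgeDisjoint′ {x} {y})
  EdgeDisjoint′-sym d hq hp = d hp hq

  IsPath⇒≢ : (w : Walk′ x y) → IsPath w → 1 ≤ length w → x ≢ y
  IsPath⇒≢ (cons _ _ w) (x∉w , _) _ refl = x∉w (end∈ w)

  IsPath-++ : (p : Walk′ x y) (q : Walk′ y z) →
              IsPath p → IsPath q → MeetAtJunction p q → IsPath (p ++ q)
  IsPath-++ nil q _ iq _ = iq
  IsPath-++ (cons e j p) q (x∉p , ip) iq m = x∉p++q , IsPath-++ p q ip iq (m ∘ inj₂)
    where
    x∉p++q : _ ∉ᵥ p ++ q
    x∉p++q h with ∈ᵥ-++⁻ p q h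
    ... | inj₁ h′ = x∉p h′
    ... | inj₂ h′ with m (inj₁ refl) h′
    ...   | refl = x∉p (end∈ p)

  IsPath-++⁻ : (p : Walk′ x y) (q : Walk′ y z) →
               IsPath (p ++ q) → IsPath p × IsPath q × MeetAtJunction p q
  IsPath-++⁻ nil q iq = tt , iq , λ h _ → h
  IsPath-++⁻ (cons e j p) q (x∉ , ipq) with IsPath-++⁻ p q ipq
  ... | ip , iq , m = (x∉ ∘ ∈ᵥ-++⁺ˡ p q , ip) , iq , m′
    where
    m′ : MeetAtJunction (cons e j p) q
    m′ (inj₁ refl) h′ = ⊥-elim (x∉ (∈ᵥ-++⁺ʳ p q h′))
    m′ (inj₂ h) h′ = m h h′

  IsPath-reverse : (w : Walk′ x y) → IsPath w → IsPath (reverse w)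
  IsPath-reverse nil _ = tt
  IsPath-reverse (cons e j w) (x∉w , iw) =
    IsPath-++ (reverse w) (cons e (Joins-sym j) nil) (IsPath-reverse w iw) ((λ { refl → x∉w (start∈ w) }) , tt) m
    where
    m : MeetAtJunction (reverse w) (cons e (Joins-sym j) nil)
    m h (inj₁ q) = q
    m h (inj₂ refl) = ⊥-elim (x∉w (∈ᵥ-reverse⁻ w h))

  record Split (w : Walk′ x y) (t : Vertex G) : Set where
    field
      prefix : Walk′ x t
      suffix : Walk′ t y
      glue : prefix ++ suffix ≡ w

    prefix⊆ : ∀ {s} → s ∈ᵥ prefix → s ∈ᵥ w
    prefix⊆ = subst (_ ∈ᵥ_) glue ∘ ∈ᵥ-++⁺ˡ prefix suffix

    suffix⊆ : ∀ {s} → s ∈ᵥ suffix → s ∈ᵥ w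
    suffix⊆ = subst (_ ∈ᵥ_) glue ∘ ∈ᵥ-++⁺ʳ prefix suffix

    prefix⊆ₑ : ∀ {f} → f ∈ₑ prefix → f ∈ₑ w
    prefix⊆ₑ = subst (_ ∈ₑ_) glue ∘ ∈ₑ-++⁺ˡ prefix suffix

    suffix⊆ₑ : ∀ {f} → f ∈ₑ suffix → f ∈ₑ w
    suffix⊆ₑ = subst (_ ∈ₑ_) glue ∘ ∈ₑ-++⁺ʳ prefix suffix

    pathParts : IsPath w → IsPath prefix × IsPath suffix × MeetAtJunction prefix suffix
    pathParts = IsPath-++⁻ prefix suffix ∘ subst IsPath (sym glue)

  atStart : (w : Walk′ x y) → Split w x
  atStart w = record { prefix = nil ; suffix = w ; glue = refl }

  consSplit : ∀ {w : Walk′ y z} e (j : Joins G e x y) → Split w t → Split (cons e j w) t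
  consSplit e j s = record { prefix = cons e j prefix ; suffix = suffix ; glue = cong (cons e j) glue }
    where open Split s

  splitAt : (w : Walk′ x y) → t ∈ᵥ w → Split w t
  splitAt nil refl = atStart nil
  splitAt (cons e j w) (inj₁ refl) = atStart (cons e j w)
  splitAt (cons e j w) (inj₂ h) = consSplit e j (splitAt w h)

  record Shortcut (w : Walk′ x y) : Set where
    field
      path : Walk′ x y
      isPath : IsPath path
      ⊆ᵥ : ∀ {t} → t ∈ᵥ path → t ∈ᵥ w
      ⊆ₑ : ∀ {f} → f ∈ₑ path → f ∈ₑ w

  shortcut : (w : Walk′ x y) → Shortcut w
  shortcut nil = record { path = nil ; isPath = tt ; ⊆ᵥ = id ; ⊆ₑ = id }
  shortcut (cons {x} e j w) with shortcut w
  ... | s with x ∈ᵥ? Shortcut.path s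
  ...   | yes h = record { path = suffix ; isPath = proj₁ (proj₂ (pathParts isPath))
                         ; ⊆ᵥ = inj₂ ∘ ⊆ᵥ ∘ suffix⊆ ; ⊆ₑ = inj₂ ∘ ⊆ₑ ∘ suffix⊆ₑ }
    where open Shortcut s
          open Split (splitAt path h)
  ...   | no x∉ = record { path = cons e j path ; isPath = x∉ , isPath
                         ; ⊆ᵥ = Data.Sum.map₂ ⊆ᵥ ; ⊆ₑ = Data.Sum.map₂ ⊆ₑ }
    where open Shortcut s

  module _ (K : Vertex G → Set) (K? : ∀ t → Dec (K t)) where

    record FirstHit (w : Walk′ x y) : Set where
      field
        hit : Vertex G
        hit∈K : K hit
        split : Split w hit
        before-clear : ∀ {t} → t ∈ᵥ Split.prefix split → t ≡ hit ⊎ ¬ K t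

    firstHit : (w : Walk′ x y) → K y → FirstHit w
    firstHit nil ky = record { hit∈K = ky ; split = atStart nil ; before-clear = inj₁ }
    firstHit (cons {x} e j w) ky with K? x
    ... | yes kx = record { hit∈K = kx ; split = atStart (cons e j w) ; before-clear = inj₁ }
    ... | no ¬kx = record { hit∈K = hit∈K ; split = consSplit e j split ; before-clear = clear }
      where
      open FirstHit (firstHit w ky)
      clear : ∀ {t} → t ∈ᵥ cons e j (Split.prefix split) → t ≡ hit ⊎ ¬ K t
      clear (inj₁ refl) = inj₂ ¬kx
      clear (inj₂ h) = before-clear h

    record LastHit (w : Walk′ x y) : Set where
      field
        hit : Vertex G
        hit∈K : K hit
        split : Split w hit
        after-clear : ∀ {t} → t ∈ᵥ Split.suffix split → t ≡ hit ⊎ ¬ K t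

    lastHit⊎clear : (w : Walk′ x y) → LastHit w ⊎ (∀ {t} → t ∈ᵥ w → ¬ K t)
    lastHit⊎clear (nil {x}) with K? x
    ... | yes kx = inj₁ record { hit∈K = kx ; split = atStart nil ; after-clear = inj₁ }
    ... | no ¬kx = inj₂ λ { refl → ¬kx }
    lastHit⊎clear (cons {x} e j w) with lastHit⊎clear w
    ... | inj₁ h = inj₁ record { LastHit h ; split = consSplit e j (LastHit.split h) }
    ... | inj₂ clear with K? x
    ...   | yes kx = inj₁ record { hit∈K = kx ; split = atStart (cons e j w)
                                 ; after-clear = λ { (inj₁ q) → inj₁ q ; (inj₂ h) → inj₂ (clear h) } }
    ...   | no ¬kx = inj₂ λ { (inj₁ refl) → ¬kx ; (inj₂ h) → clear h }

    lastHit : (w : Walk′ x y) → K x → LastHit w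
    lastHit w kx = [ id , (λ clear → ⊥-elim (clear (start∈ w) kx)) ]′ (lastHit⊎clear w)

  secondVertex-inner : ∀ {x₁ x₂} e₁ (j₁ : Joins G e₁ x x₁) e₂ (j₂ : Joins G e₂ x₁ x₂) (r : Walk′ x₂ y) →
                       IsPath (cons e₁ j₁ (cons e₂ j₂ r)) → x₁ ≢ x × x₁ ≢ y
  secondVertex-inner _ _ _ _ r (x∉ , x₁∉r , _) = (λ { refl → x∉ (inj₁ refl) }) , (λ { refl → x₁∉r (end∈ r) })

  innerEnd : (p : Walk′ x y) → IsPath p → 2 ≤ length p → f ∈ₑ p →
             ∃[ t ] Incident G f t × t ∈ᵥ p × t ≢ x × t ≢ y
  innerEnd (cons _ _ nil) _ (s≤s ()) _
  innerEnd (cons e j (cons e′ j′ r)) ip _ (inj₁ refl) =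
    _ , Joins⇒Incidentʳ j , inj₂ (inj₁ refl) , secondVertex-inner e j e′ j′ r ip
  innerEnd (cons e j (cons e′ j′ r)) ip _ (inj₂ (inj₁ refl)) =
    _ , Joins⇒Incidentˡ j′ , inj₂ (inj₁ refl) , secondVertex-inner e j e′ j′ r ip
  innerEnd (cons e j (cons e′ j′ nil)) _ _ (inj₂ (inj₂ ()))
  innerEnd (cons e j w@(cons e′ j′ (cons _ _ _))) (x∉w , ipw) _ (inj₂ (inj₂ h))
    with innerEnd w ipw (s≤s (s≤s z≤n)) (inj₂ h)
  ... | t , it , t∈w , _ , t≢y = t , it , inj₂ t∈w , (λ { refl → x∉w t∈w }) , t≢y

  InnerDisjoint′⇒EdgeDisjoint′ : (p q : Walk′ x y) → IsPath p → 2 ≤ length p →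
                                 InnerDisjoint′ p q → EdgeDisjoint′ p q
  InnerDisjoint′⇒EdgeDisjoint′ p q ip l d hp hq with innerEnd p ip l hp
  ... | t , it , t∈p , t≢x , t≢y = [ t≢x , t≢y ]′ (d t∈p (∈ₑ⇒ends∈ᵥ q hq it))

  fromWalk : ∀ {F} → Walk G F x y → Walk′ x y
  fromWalk nil = nil
  fromWalk (cons e _ j w) = cons e j (fromWalk w)

  fromWalk-edges : ∀ {F} (w : Walk G F x y) → f ∈ₑ fromWalk w → F f
  fromWalk-edges (cons e fe j w) (inj₁ refl) = fe
  fromWalk-edges (cons e fe j w) (inj₂ h) = fromWalk-edges w h

  fromWalk-invariant : ∀ {F} (P : Vertex G → Set) (w : Walk G F x y) →
                       (∀ {e a b} → F e → Joins G e a b → P b) → P x → t ∈ᵥ fromWalk w → P t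
  fromWalk-invariant P nil step px refl = px
  fromWalk-invariant P (cons e fe j w) step px (inj₁ refl) = px
  fromWalk-invariant P (cons e fe j w) step px (inj₂ h) = fromWalk-invariant P w step (step fe j) h

  fromWalk-avoids : ∀ {F s} (w : Walk G F x y) → (∀ {e} → F e → ¬ Incident G e s) →
                    x ≢ s → t ∈ᵥ fromWalk w → t ≢ s
  fromWalk-avoids {s = s} w avoid =
    fromWalk-invariant (_≢ s) w (λ fe j → λ { refl → avoid fe (Joins⇒Incidentʳ j) })

  vertexAt : (w : Walk′ x y) → Fin (suc (length w)) → Vertex G
  vertexAt {x} w zero = x
  vertexAt (cons _ _ w) (suc i) = vertexAt w i

  edgeAt : (w : Walk′ x y) → Fin (length w) → Edge G
  edgeAt (cons e _ _) zero = e
  edgeAt (cons _ _ w) (suc i) = edgeAt w i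

  edgeAt-joins : (w : Walk′ x y) (i : Fin (length w)) →
                 Joins G (edgeAt w i) (vertexAt w (inject₁ i)) (vertexAt w (suc i))
  edgeAt-joins (cons _ j _) zero = j
  edgeAt-joins (cons _ _ w) (suc i) = edgeAt-joins w i

  edgeAt-∈ : (w : Walk′ x y) (i : Fin (length w)) → edgeAt w i ∈ₑ w
  edgeAt-∈ (cons _ _ _) zero = inj₁ refl
  edgeAt-∈ (cons _ _ w) (suc i) = inj₂ (edgeAt-∈ w i)

  vertexAt-∈ : (w : Walk′ x y) (i : Fin (suc (length w))) → vertexAt w i ∈ᵥ w
  vertexAt-∈ w zero = start∈ w
  vertexAt-∈ (cons _ _ w) (suc i) = inj₂ (vertexAt-∈ w i)

  ∈⇒vertexAt : (w : Walk′ x y) → t ∈ᵥ w → ∃[ i ] vertexAt w i ≡ t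
  ∈⇒vertexAt nil refl = zero , refl
  ∈⇒vertexAt (cons _ _ _) (inj₁ refl) = zero , refl
  ∈⇒vertexAt (cons _ _ w) (inj₂ h) with ∈⇒vertexAt w h
  ... | i , eq = suc i , eq

  vertexAt-last : (w : Walk′ x y) → vertexAt w (fromℕ (length w)) ≡ y
  vertexAt-last nil = refl
  vertexAt-last (cons _ _ w) = vertexAt-last w

  vertexAt-injective : (w : Walk′ x y) → IsPath w → Injective _≡_ _≡_ (vertexAt w)
  vertexAt-injective w _ {zero} {zero} _ = refl
  vertexAt-injective (cons _ _ w) (x∉w , _) {zero} {suc j} refl = ⊥-elim (x∉w (vertexAt-∈ w j))
  vertexAt-injective (cons _ _ w) (x∉w , _) {suc i} {zero} eq = ⊥-elim (x∉w (subst (_∈ᵥ w) eq (vertexAt-∈ w i)))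
  vertexAt-injective (cons _ _ w) (_ , ip) {suc i} {suc j} eq = cong suc (vertexAt-injective w ip eq)

  record Traces (P : Path G) (w : Walk′ x y) : Set where
    field
      start≡ : Path.start P ≡ x
      end≡ : Path.end P ≡ y
      numEdges≡ : Path.numEdges P ≡ length w
      on⁺ : ∀ {t} → t ∈ᵥ w → Path.OnPath P t
      on⁻ : ∀ {t} → Path.OnPath P t → t ∈ᵥ w
      edge∈ : ∀ i → Path.edge P i ∈ₑ w

  toPath : (w : Walk′ x y) → IsPath w → x ≢ y → Σ (Path G) λ P → Traces P w
  toPath nil _ x≢x = ⊥-elim (x≢x refl)
  toPath w@(cons _ _ w′) ip _ = P , traces
    where
    P : Path G
    P = record { len = length w′ ; vtx = vertexAt w ; vtx-inj = vertexAt-injective w ip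
               ; edge = edgeAt w ; joins = edgeAt-joins w }
    traces : Traces P w
    traces = record { start≡ = refl ; end≡ = vertexAt-last w ; numEdges≡ = refl
                    ; on⁺ = ∈⇒vertexAt w ; on⁻ = λ { (i , refl) → vertexAt-∈ w i } ; edge∈ = edgeAt-∈ w }

  walkThrough : (n : ℕ) (vtx : Fin (suc n) → Vertex G) (edge : Fin n → Edge G) →
                (∀ i → Joins G (edge i) (vtx (inject₁ i)) (vtx (suc i))) → Walk′ (vtx zero) (vtx (fromℕ n))
  walkThrough zero vtx edge joins = nil
  walkThrough (suc n) vtx edge joins =
    cons (edge zero) (joins zero) (walkThrough n (vtx ∘ suc) (edge ∘ suc) (joins ∘ suc))

  walkThrough-length : ∀ n vtx edge joins → length (walkThrough n vtx edge joins) ≡ n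
  walkThrough-length zero vtx edge joins = refl
  walkThrough-length (suc n) vtx edge joins = cong suc (walkThrough-length n (vtx ∘ suc) (edge ∘ suc) (joins ∘ suc))

  walkThrough-∈ᵥ : ∀ n vtx edge joins → t ∈ᵥ walkThrough n vtx edge joins → ∃[ i ] vtx i ≡ t
  walkThrough-∈ᵥ zero vtx edge joins refl = zero , refl
  walkThrough-∈ᵥ (suc n) vtx edge joins (inj₁ refl) = zero , refl
  walkThrough-∈ᵥ (suc n) vtx edge joins (inj₂ h) with walkThrough-∈ᵥ n (vtx ∘ suc) (edge ∘ suc) (joins ∘ suc) h
  ... | i , eq = suc i , eq

  walkThrough-∈ₑ : ∀ n vtx edge joins → f ∈ₑ walkThrough n vtx edge joins → ∃[ i ] edge i ≡ f
  walkThrough-∈ₑ (suc n) vtx edge joins (inj₁ refl) = zero , refl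
  walkThrough-∈ₑ (suc n) vtx edge joins (inj₂ h) with walkThrough-∈ₑ n (vtx ∘ suc) (edge ∘ suc) (joins ∘ suc) h
  ... | i , eq = suc i , eq

  walkThrough-isPath : ∀ n vtx edge joins → Injective _≡_ _≡_ vtx → IsPath (walkThrough n vtx edge joins)
  walkThrough-isPath zero vtx edge joins inj = tt
  walkThrough-isPath (suc n) vtx edge joins inj =
    (λ h → 0≢1+n (sym (inj (proj₂ (walkThrough-∈ᵥ n (vtx ∘ suc) (edge ∘ suc) (joins ∘ suc) h))))) ,
    walkThrough-isPath n (vtx ∘ suc) (edge ∘ suc) (joins ∘ suc) (suc-injective ∘ inj)

module Parity (G : Graph) (colour : Vertex G → Bool) (proper : ∀ e → colour (src G e) ≢ colour (tgt G e)) where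

  open Walks G

  private variable
    x y : Vertex G
    e : Edge G

  Even : ℕ → Set
  Even n = ∃[ j ] n ≡ 2 * j

  Joins⇒colour-flips : Joins G e x y → colour y ≡ not (colour x)
  Joins⇒colour-flips {e} (inj₁ (refl , refl)) = ¬-not (proper e ∘ sym)
  Joins⇒colour-flips {e} (inj₂ (refl , refl)) = ¬-not (proper e)

  walk-parity : (w : Walk′ x y) → (colour x ≡ colour y → Even (length w)) × (colour x ≢ colour y → Odd (length w))
  walk-parity nil = (λ _ → 0 , refl) , (λ x≢x → ⊥-elim (x≢x refl))
  walk-parity {x} {y} (cons e j w) with walk-parity w | Joins⇒colour-flips j
  ... | even , odd | flip = (λ same → odd⇒suc-even (odd (λ eq → not-¬ (sym same) (trans (sym eq) flip))))
                          , (λ differ → even⇒suc-odd (even (trans flip (sym (¬-not (differ ∘ sym))))))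
    where
    odd⇒suc-even : ∀ {n} → Odd n → Even (suc n)
    odd⇒suc-even (k , eq) = suc k , trans (cong suc eq) (sym (*-suc 2 k))
    even⇒suc-odd : ∀ {n} → Even n → Odd (suc n)
    even⇒suc-odd (k , eq) = k , cong suc eq

  odd⇒colours-differ : (w : Walk′ x y) → Odd (length w) → colour x ≢ colour y
  odd⇒colours-differ w (k , eq) same with proj₁ (walk-parity w) same
  ... | j , eq′ = even≢odd j k (trans (sym eq′) eq)

Pairwise : ∀ {A : Set} {n} → (A → A → Set) → Vector A n → Set
Pairwise R xs = ∀ i j → i ≢ j → R (xs i) (xs j)

module _ {A : Set} {R : A → A → Set} (R-sym : Symmetric R) where

  Pairwise-triple : ∀ {a b c} → R a b → R a c → R b c → Pairwise R (a ∷ b ∷ c ∷ [])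
  Pairwise-triple ab ac bc zero zero 0≢0 = ⊥-elim (0≢0 refl)
  Pairwise-triple ab ac bc zero (suc zero) _ = ab
  Pairwise-triple ab ac bc zero (suc (suc zero)) _ = ac
  Pairwise-triple ab ac bc (suc zero) zero _ = R-sym ab
  Pairwise-triple ab ac bc (suc zero) (suc zero) 1≢1 = ⊥-elim (1≢1 refl)
  Pairwise-triple ab ac bc (suc zero) (suc (suc zero)) _ = bc
  Pairwise-triple ab ac bc (suc (suc zero)) zero _ = R-sym ac
  Pairwise-triple ab ac bc (suc (suc zero)) (suc zero) _ = R-sym bc
  Pairwise-triple ab ac bc (suc (suc zero)) (suc (suc zero)) 2≢2 = ⊥-elim (2≢2 refl)

  Pairwise-updateAt : ∀ {n} {xs : Vector A n} {i a} → Pairwise R xs → (∀ j → j ≢ i → R a (xs j)) →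
                      Pairwise R (updateAt xs i (const a))
  Pairwise-updateAt {xs = xs} {i} pw new j k j≢k with j ≟ᶠ i | k ≟ᶠ i
  ... | yes refl | yes refl = ⊥-elim (j≢k refl)
  ... | yes refl | no k≢i = subst₂ R (sym (updateAt-updates i xs)) (sym (updateAt-minimal k i xs k≢i)) (new k k≢i)
  ... | no j≢i | yes refl = subst₂ R (sym (updateAt-minimal j i xs j≢i)) (sym (updateAt-updates i xs)) (R-sym (new j j≢i))
  ... | no j≢i | no k≢i = subst₂ R (sym (updateAt-minimal j i xs j≢i)) (sym (updateAt-minimal k i xs k≢i)) (pw j k j≢k)

updateAt-const : ∀ {A : Set} {n} (xs : Vector A n) i a j →
                 updateAt xs i (const a) j ≡ a ⊎ updateAt xs i (const a) j ≡ xs j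
updateAt-const xs i a j with j ≟ᶠ i
... | yes refl = inj₁ (updateAt-updates i xs)
... | no j≢i = inj₂ (updateAt-minimal j i xs j≢i)

module Thetas (G : Graph) (colour : Vertex G → Bool) (proper : ∀ e → colour (src G e) ≢ colour (tgt G e)) where

  open Walks G
  open Parity G colour proper

  private variable
    x y t : Vertex G

  -- Different colours of u and v make all three paths odd (walk-parity).
  record Theta : Set where
    field
      u v : Vertex G
      colours-differ : colour u ≢ colour v
      path : Vector (Walk′ u v) 3
      isPath : ∀ i → IsPath (path i)
      innerDisjoint : Pairwise InnerDisjoint′ path
      edgeDisjoint : Pairwise EdgeDisjoint′ path

    u≢v : u ≢ v
    u≢v = colours-differ ∘ cong colour

  infix 4 _∈θ_
  _∈θ_ : Vertex G → Theta → Set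
  t ∈θ T = ∃[ i ] t ∈ᵥ Theta.path T i

  _∈θ?_ : ∀ t T → Dec (t ∈θ T)
  t ∈θ? T = any? (λ i → t ∈ᵥ? Theta.path T i)

  mkTheta : ∀ {u v} → colour u ≢ colour v → (p q r : Walk′ u v) → IsPath p → IsPath q → IsPath r →
            InnerDisjoint′ p q → InnerDisjoint′ p r → InnerDisjoint′ q r →
            EdgeDisjoint′ p q → EdgeDisjoint′ p r → EdgeDisjoint′ q r → Theta
  mkTheta differ p q r ip iq ir pq pr qr pq′ pr′ qr′ = record
    { colours-differ = differ
    ; path = p ∷ q ∷ r ∷ []
    ; isPath = λ { zero → ip ; (suc zero) → iq ; (suc (suc zero)) → ir }
    ; innerDisjoint = Pairwise-triple {R = InnerDisjoint′} InnerDisjoint′-sym pq pr qr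
    ; edgeDisjoint = Pairwise-triple {R = EdgeDisjoint′} EdgeDisjoint′-sym pq′ pr′ qr′
    }

  Theta-reverse : Theta → Theta
  Theta-reverse T = record
    { colours-differ = colours-differ ∘ sym
    ; path = reverse ∘ path
    ; isPath = λ i → IsPath-reverse (path i) (isPath i)
    ; innerDisjoint = λ i j i≢j hi hj →
        Data.Sum.swap (innerDisjoint i j i≢j (∈ᵥ-reverse⁻ (path i) hi) (∈ᵥ-reverse⁻ (path j) hj))
    ; edgeDisjoint = λ i j i≢j hi hj → edgeDisjoint i j i≢j (∈ₑ-reverse⁻ (path i) hi) (∈ₑ-reverse⁻ (path j) hj)
    }
    where open Theta T

  ∈θ-reverse⁺ : ∀ T → t ∈θ T → t ∈θ Theta-reverse T
  ∈θ-reverse⁺ T (i , h) = i , ∈ᵥ-reverse⁺ (Theta.path T i) h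

  ∈θ-reverse⁻ : ∀ T → t ∈θ Theta-reverse T → t ∈θ T
  ∈θ-reverse⁻ T (i , h) = i , ∈ᵥ-reverse⁻ (Theta.path T i) h

  -- Length at least 2 makes the new paths built from Q edge-disjoint from the old ones.
  record ThetaEar (T : Theta) (Q : Walk′ x y) : Set where
    field
      isPath : IsPath Q
      long : 2 ≤ length Q
      start∈θ : x ∈θ T
      end∈θ : y ∈θ T
      touch : ∀ {t} → t ∈ᵥ Q → t ∈θ T → t ≡ x ⊎ t ≡ y

    ends-differ : x ≢ y
    ends-differ = IsPath⇒≢ Q isPath (≤-trans (s≤s z≤n) long)

  ThetaEar-reverse : ∀ {T} {Q : Walk′ x y} → ThetaEar T Q → ThetaEar T (reverse Q)
  ThetaEar-reverse {Q = Q} ear = record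
    { isPath = IsPath-reverse Q isPath
    ; long = subst (2 ≤_) (sym (length-reverse Q)) long
    ; start∈θ = end∈θ
    ; end∈θ = start∈θ
    ; touch = λ h h′ → Data.Sum.swap (touch (∈ᵥ-reverse⁻ Q h) h′)
    }
    where open ThetaEar ear

  ThetaEar-Theta-reverse : ∀ {T} {Q : Walk′ x y} → ThetaEar T Q → ThetaEar (Theta-reverse T) Q
  ThetaEar-Theta-reverse {T = T} ear = record
    { isPath = isPath
    ; long = long
    ; start∈θ = ∈θ-reverse⁺ T start∈θ
    ; end∈θ = ∈θ-reverse⁺ T end∈θ
    ; touch = λ h h′ → touch h (∈θ-reverse⁻ T h′)
    }
    where open ThetaEar ear

  record Extension (T : Theta) (Q : Walk′ x y) : Set where
    field
      theta : Theta
      covers : ∀ {t} → t ∈ᵥ Q → t ∈θ theta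
      within : ∀ {t} → t ∈θ theta → t ∈θ T ⊎ t ∈ᵥ Q

  Extension-transfer : ∀ {x′ y′ T T′} {Q : Walk′ x y} {Q′ : Walk′ x′ y′} → Extension T′ Q′ →
                       (∀ {t} → t ∈θ T′ → t ∈θ T) → (∀ {t} → t ∈ᵥ Q → t ∈ᵥ Q′) →
                       (∀ {t} → t ∈ᵥ Q′ → t ∈θ T ⊎ t ∈ᵥ Q) → Extension T Q
  Extension-transfer ext T′⊆T Q⊆Q′ Q′⊆ = record
    { theta = theta
    ; covers = covers ∘ Q⊆Q′
    ; within = [ inj₁ ∘ T′⊆T , Q′⊆ ]′ ∘ within
    }
    where open Extension ext

  replacePath : (T : Theta) (i : Fin 3) (N : Walk′ (Theta.u T) (Theta.v T)) → IsPath N → 2 ≤ length N →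
                (∀ k → k ≢ i → InnerDisjoint′ N (Theta.path T k)) → Extension T N
  replacePath T i N iN lN disjoint = record
    { theta = record T
        { path = path′
        ; isPath = λ k → [ (λ eq → subst IsPath (sym eq) iN) , (λ eq → subst IsPath (sym eq) (isPath k)) ]′
                             (updateAt-const path i N k)
        ; innerDisjoint = Pairwise-updateAt {R = InnerDisjoint′} InnerDisjoint′-sym innerDisjoint disjoint
        ; edgeDisjoint = Pairwise-updateAt {R = EdgeDisjoint′} EdgeDisjoint′-sym edgeDisjoint
            (λ k k≢i → InnerDisjoint′⇒EdgeDisjoint′ N (path k) iN lN (disjoint k k≢i))
        }
    ; covers = λ h → i , subst (_ ∈ᵥ_) (sym (updateAt-updates i path)) h
    ; within = λ { (k , h) → [ (λ eq → inj₂ (subst (_ ∈ᵥ_) eq h)) , (λ eq → inj₁ (k , subst (_ ∈ᵥ_) eq h)) ]′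
                                (updateAt-const path i N k) }
    }
    where
    open Theta T
    path′ : Vector (Walk′ u v) 3
    path′ = updateAt path i (const N)

  module Splice (T : Theta) (i : Fin 3) {x y : Vertex G}
    (A : Walk′ (Theta.u T) x) (M : Walk′ x y) (B : Walk′ y (Theta.v T)) (glue : A ++ M ++ B ≡ Theta.path T i)
    (Q : Walk′ x y) (ear : ThetaEar T Q) where

    open Theta T
    open ThetaEar ear using (long; touch; ends-differ) renaming (isPath to Q-isPath)
    N : Walk′ u v
    N = A ++ Q ++ B
    inA : ∀ {t} → t ∈ᵥ A → t ∈ᵥ path i
    inA = subst (_ ∈ᵥ_) glue ∘ ∈ᵥ-++⁺ˡ A (M ++ B)
    inB : ∀ {t} → t ∈ᵥ B → t ∈ᵥ path i
    inB = subst (_ ∈ᵥ_) glue ∘ ∈ᵥ-++⁺ʳ A (M ++ B) ∘ ∈ᵥ-++⁺ʳ M B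
    A-parts = IsPath-++⁻ A (M ++ B) (subst IsPath (sym glue) (isPath i))
    B-parts = IsPath-++⁻ M B (proj₁ (proj₂ A-parts))
    x∉B : x ∉ᵥ B
    x∉B h = ends-differ (proj₂ (proj₂ B-parts) (start∈ M) h)
    y∉A : y ∉ᵥ A
    y∉A h = ends-differ (sym (proj₂ (proj₂ A-parts) h (∈ᵥ-++⁺ˡ M B (end∈ M))))
    iQB : IsPath (Q ++ B)
    iQB = IsPath-++ Q B Q-isPath (proj₁ (proj₂ B-parts)) junction
      where
      junction : MeetAtJunction Q B
      junction hq hb with touch hq (i , inB hb)
      ... | inj₁ refl = ⊥-elim (x∉B hb)
      ... | inj₂ eq = eq
    iN : IsPath N
    iN = IsPath-++ A (Q ++ B) (proj₁ A-parts) iQB junction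
      where
      junction : MeetAtJunction A (Q ++ B)
      junction ha h with ∈ᵥ-++⁻ Q B h
      ... | inj₂ hb = proj₂ (proj₂ A-parts) ha (∈ᵥ-++⁺ʳ M B hb)
      ... | inj₁ hq with touch hq (i , inA ha)
      ...   | inj₁ eq = eq
      ...   | inj₂ refl = ⊥-elim (y∉A ha)
    lN : 2 ≤ length N
    lN = ≤-trans long (≤-trans (length-≤-++ˡ Q B) (length-≤-++ʳ A (Q ++ B)))
    N⊆ : ∀ {t} → t ∈ᵥ N → t ∈ᵥ path i ⊎ t ∈ᵥ Q
    N⊆ h with ∈ᵥ-++⁻ A (Q ++ B) h
    ... | inj₁ ha = inj₁ (inA ha)
    ... | inj₂ h′ = Data.Sum.map₁ inB (Data.Sum.swap (∈ᵥ-++⁻ Q B h′))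
    disjoint : ∀ k → k ≢ i → InnerDisjoint′ N (path k)
    disjoint k k≢i hN hk with N⊆ hN
    ... | inj₁ hi = innerDisjoint i k (k≢i ∘ sym) hi hk
    ... | inj₂ hq with touch hq (k , hk)
    ...   | inj₁ refl = innerDisjoint i k (k≢i ∘ sym) (inA (end∈ A)) hk
    ...   | inj₂ refl = innerDisjoint i k (k≢i ∘ sym) (inB (start∈ B)) hk

    extension : Extension T Q
    extension = Extension-transfer (replacePath T i N iN lN disjoint) id (∈ᵥ-++⁺ʳ A (Q ++ B) ∘ ∈ᵥ-++⁺ˡ Q B)
                                   (Data.Sum.map₁ (i ,_) ∘ N⊆)

  spliceAt : (T : Theta) (i : Fin 3) → x ∈ᵥ Theta.path T i → y ∈ᵥ Theta.path T i →
             (Q : Walk′ x y) → ThetaEar T Q → Extension T Q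
  spliceAt {y = y} T i x∈ y∈ Q ear with splitAt (Theta.path T i) x∈
  ... | sx with y ∈ᵥ? Split.suffix sx
  ...   | yes y∈B = Splice.extension T i prefix M B (trans (cong (prefix ++_) glue′) glue) Q ear
    where
    open Split sx
    open Split (splitAt suffix y∈B) renaming (prefix to M; suffix to B; glue to glue′)
  ...   | no y∉B = Extension-transfer (Splice.extension T i A M suffix glue″ (reverse Q) (ThetaEar-reverse ear))
                                      id (∈ᵥ-reverse⁺ Q) (inj₂ ∘ ∈ᵥ-reverse⁻ Q)
    where
    open Split sx
    y∈A : y ∈ᵥ prefix
    y∈A = [ id , (λ h → ⊥-elim (y∉B h)) ]′ (∈ᵥ-++⁻ prefix suffix (subst (y ∈ᵥ_) (sym glue) y∈))
    open Split (splitAt prefix y∈A) renaming (prefix to A; suffix to M; glue to glue′)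
    glue″ : A ++ M ++ suffix ≡ Theta.path T i
    glue″ = trans (sym (++-assoc A M suffix)) (trans (cong (_++ suffix) glue′) glue)

  -- The new theta has ends u and y; its paths are path j up to y, path i up to x followed by Q,
  -- and path k followed by the rest of path j backwards.
  module Reroute (T : Theta) {i j k : Fin 3} (i≢j : i ≢ j) (i≢k : i ≢ k) (j≢k : j ≢ k) {x y : Vertex G}
    (x∈i : x ∈ᵥ Theta.path T i) (x∉j : x ∉ᵥ Theta.path T j)
    (y∈j : y ∈ᵥ Theta.path T j) (y∉i : y ∉ᵥ Theta.path T i)
    (differ : colour (Theta.u T) ≢ colour y) (Q : Walk′ x y) (ear : ThetaEar T Q) where

    open Theta T
    open ThetaEar ear using (long; touch) renaming (isPath to Q-isPath)
    sx = splitAt (path i) x∈i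
    sy = splitAt (path j) y∈j
    open Split sx using () renaming (prefix to A₁; suffix to B₁; prefix⊆ to A₁⊆)
    open Split sy using () renaming (prefix to A₂; suffix to B₂; prefix⊆ to A₂⊆; suffix⊆ to B₂⊆)
    x-parts = Split.pathParts sx (isPath i)
    y-parts = Split.pathParts sy (isPath j)
    B₂⊆′ : ∀ {t} → t ∈ᵥ reverse B₂ → t ∈ᵥ path j
    B₂⊆′ = B₂⊆ ∘ ∈ᵥ-reverse⁻ B₂
    y≢v : y ≢ v
    y≢v eq = y∉i (subst (_∈ᵥ path i) (sym eq) (end∈ (path i)))
    v∉A₁ : v ∉ᵥ A₁
    v∉A₁ h = x∉j (subst (_∈ᵥ path j) (proj₂ (proj₂ x-parts) h (end∈ B₁)) (end∈ (path j)))
    v∉A₂ : v ∉ᵥ A₂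
    v∉A₂ h = y≢v (sym (proj₂ (proj₂ y-parts) h (end∈ B₂)))
    u∉B₂ : u ∉ᵥ B₂
    u∉B₂ h = y∉i (subst (_∈ᵥ path i) (proj₂ (proj₂ y-parts) (start∈ A₂) h) (start∈ (path i)))
    x∉k : x ∉ᵥ path k
    x∉k h with innerDisjoint i k i≢k x∈i h
    ... | inj₁ refl = x∉j (start∈ (path j))
    ... | inj₂ refl = x∉j (end∈ (path j))
    q₁ q₂ : Walk′ u y
    q₁ = A₁ ++ Q
    q₂ = path k ++ reverse B₂
    iq₁ : IsPath q₁
    iq₁ = IsPath-++ A₁ Q (proj₁ x-parts) Q-isPath junction
      where
      junction : MeetAtJunction A₁ Q
      junction ha hq with touch hq (i , A₁⊆ ha)
      ... | inj₁ eq = eq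
      ... | inj₂ refl = ⊥-elim (y∉i (A₁⊆ ha))
    iq₂ : IsPath q₂
    iq₂ = IsPath-++ (path k) (reverse B₂) (isPath k) (IsPath-reverse B₂ (proj₁ (proj₂ y-parts))) junction
      where
      junction : MeetAtJunction (path k) (reverse B₂)
      junction hk hb with innerDisjoint k j (j≢k ∘ sym) hk (B₂⊆′ hb)
      ... | inj₁ refl = ⊥-elim (u∉B₂ (∈ᵥ-reverse⁻ B₂ hb))
      ... | inj₂ eq = eq
    lq₁ : 2 ≤ length q₁
    lq₁ = ≤-trans long (length-≤-++ʳ A₁ Q)
    lq₂ : 2 ≤ length q₂
    lq₂ = ++-long (path k) (reverse B₂) (length-pos (path k) u≢v) (length-pos (reverse B₂) (y≢v ∘ sym))
    d₀₁ : InnerDisjoint′ A₂ q₁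
    d₀₁ h₂ h with ∈ᵥ-++⁻ A₁ Q h
    ... | inj₁ h₁ with innerDisjoint i j i≢j (A₁⊆ h₁) (A₂⊆ h₂)
    ...   | inj₁ eq = inj₁ eq
    ...   | inj₂ refl = ⊥-elim (v∉A₂ h₂)
    d₀₁ h₂ h | inj₂ hq with touch hq (j , A₂⊆ h₂)
    ...   | inj₁ refl = ⊥-elim (x∉j (A₂⊆ h₂))
    ...   | inj₂ eq = inj₂ eq
    d₀₂ : InnerDisjoint′ A₂ q₂
    d₀₂ h₂ h with ∈ᵥ-++⁻ (path k) (reverse B₂) h
    ... | inj₁ hk with innerDisjoint j k j≢k (A₂⊆ h₂) hk
    ...   | inj₁ eq = inj₁ eq
    ...   | inj₂ refl = ⊥-elim (v∉A₂ h₂)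
    d₀₂ h₂ h | inj₂ hb = inj₂ (proj₂ (proj₂ y-parts) h₂ (∈ᵥ-reverse⁻ B₂ hb))
    d₁₂ : InnerDisjoint′ q₁ q₂
    d₁₂ h h′ with ∈ᵥ-++⁻ A₁ Q h | ∈ᵥ-++⁻ (path k) (reverse B₂) h′
    ... | inj₁ h₁ | inj₁ hk with innerDisjoint i k i≢k (A₁⊆ h₁) hk
    ...   | inj₁ eq = inj₁ eq
    ...   | inj₂ refl = ⊥-elim (v∉A₁ h₁)
    d₁₂ h h′ | inj₁ h₁ | inj₂ hb with innerDisjoint i j i≢j (A₁⊆ h₁) (B₂⊆′ hb)
    ...   | inj₁ refl = ⊥-elim (u∉B₂ (∈ᵥ-reverse⁻ B₂ hb))
    ...   | inj₂ refl = ⊥-elim (v∉A₁ h₁)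
    d₁₂ h h′ | inj₂ hq | inj₁ hk with touch hq (k , hk)
    ...   | inj₁ refl = ⊥-elim (x∉k hk)
    ...   | inj₂ eq = inj₂ eq
    d₁₂ h h′ | inj₂ hq | inj₂ hb with touch hq (j , B₂⊆′ hb)
    ...   | inj₁ refl = ⊥-elim (x∉j (B₂⊆′ hb))
    ...   | inj₂ eq = inj₂ eq
    theta′ : Theta
    theta′ = mkTheta differ A₂ q₁ q₂ (proj₁ y-parts) iq₁ iq₂ d₀₁ d₀₂ d₁₂
      (EdgeDisjoint′-sym (InnerDisjoint′⇒EdgeDisjoint′ q₁ A₂ iq₁ lq₁ (InnerDisjoint′-sym d₀₁)))
      (EdgeDisjoint′-sym (InnerDisjoint′⇒EdgeDisjoint′ q₂ A₂ iq₂ lq₂ (InnerDisjoint′-sym d₀₂)))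
      (InnerDisjoint′⇒EdgeDisjoint′ q₁ q₂ iq₁ lq₁ d₁₂)
    within : ∀ {t} → t ∈θ theta′ → t ∈θ T ⊎ t ∈ᵥ Q
    within (zero , h) = inj₁ (j , A₂⊆ h)
    within (suc zero , h) = Data.Sum.map₁ (λ h₁ → i , A₁⊆ h₁) (∈ᵥ-++⁻ A₁ Q h)
    within (suc (suc zero) , h) = inj₁ ([ (k ,_) , (λ hb → j , B₂⊆′ hb) ]′ (∈ᵥ-++⁻ (path k) (reverse B₂) h))

    extension : Extension T Q
    extension = record { theta = theta′ ; covers = λ h → suc zero , ∈ᵥ-++⁺ʳ A₁ Q h ; within = within }

  third : (i j : Fin 3) → i ≢ j → ∃[ k ] i ≢ k × j ≢ k
  third zero zero 0≢0 = ⊥-elim (0≢0 refl)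
  third zero (suc zero) _ = suc (suc zero) , (λ ()) , (λ ())
  third zero (suc (suc zero)) _ = suc zero , (λ ()) , (λ ())
  third (suc zero) zero _ = suc (suc zero) , (λ ()) , (λ ())
  third (suc zero) (suc zero) 1≢1 = ⊥-elim (1≢1 refl)
  third (suc zero) (suc (suc zero)) _ = zero , (λ ()) , (λ ())
  third (suc (suc zero)) zero _ = suc zero , (λ ()) , (λ ())
  third (suc (suc zero)) (suc zero) _ = zero , (λ ()) , (λ ())
  third (suc (suc zero)) (suc (suc zero)) 2≢2 = ⊥-elim (2≢2 refl)

  rerouteEither : (T : Theta) {i j : Fin 3} →
                  x ∈ᵥ Theta.path T i → x ∉ᵥ Theta.path T j → y ∈ᵥ Theta.path T j → y ∉ᵥ Theta.path T i →
                  (Q : Walk′ x y) → ThetaEar T Q → Extension T Q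
  rerouteEither {y = y} T {i} {j} x∈i x∉j y∈j y∉i Q ear = choose (third i j i≢j) (colour u ≟ᵇ colour y)
    where
    open Theta T
    i≢j : i ≢ j
    i≢j eq = y∉i (subst (λ l → y ∈ᵥ path l) (sym eq) y∈j)
    choose : ∃[ k ] i ≢ k × j ≢ k → Dec (colour u ≡ colour y) → Extension T Q
    choose (k , i≢k , j≢k) (no differ) = Reroute.extension T i≢j i≢k j≢k x∈i x∉j y∈j y∉i differ Q ear
    -- colour u ≡ colour y forces colour v ≢ colour y: reroute the reversed theta.
    choose (k , i≢k , j≢k) (yes same) =
      Extension-transfer
        (Reroute.extension (Theta-reverse T) i≢j i≢k j≢k
                 (∈ᵥ-reverse⁺ (path i) x∈i) (x∉j ∘ ∈ᵥ-reverse⁻ (path j))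
                 (∈ᵥ-reverse⁺ (path j) y∈j) (y∉i ∘ ∈ᵥ-reverse⁻ (path i))
                 (λ eq → colours-differ (trans same (sym eq))) Q (ThetaEar-Theta-reverse ear))
        (∈θ-reverse⁻ T) id inj₂

  addEar : (T : Theta) (Q : Walk′ x y) → ThetaEar T Q → Extension T Q
  addEar {x} {y} T Q ear with ThetaEar.start∈θ ear | ThetaEar.end∈θ ear
  ... | i , x∈i | j , y∈j with y ∈ᵥ? Theta.path T i | x ∈ᵥ? Theta.path T j
  ...   | yes y∈i | _ = spliceAt T i x∈i y∈i Q ear
  ...   | no _ | yes x∈j = spliceAt T j x∈j y∈j Q ear
  ...   | no y∉i | no x∉j = rerouteEither T x∈i x∉j y∈j y∉i Q ear

  otherVertex : (T : Theta) (x : Vertex G) → ∃[ y ] y ∈θ T × y ≢ x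
  otherVertex T x with x ≟ᶠ Theta.u T
  ... | yes refl = Theta.v T , (zero , end∈ (Theta.path T zero)) , Theta.u≢v T ∘ sym
  ... | no x≢u = Theta.u T , (zero , start∈ (Theta.path T zero)) , x≢u ∘ sym

  record Approach (T : Theta) (w : Vertex G) : Set where
    field
      target : Vertex G
      route : Walk′ w target
      isPath : IsPath route
      target∈θ : target ∈θ T
      clear : ∀ {t} → t ∈ᵥ route → t ≡ target ⊎ ¬ t ∈θ T

  -- R₁ ++ R₂ is a route from w to x and S a detour from its vertex z to the theta, avoiding x;
  -- adding the ear reverse R₂ ++ S leaves the shorter route R₁ from w to the new theta.
  module Detour {T : Theta} {w x y z : Vertex G}
    (R₁ : Walk′ w z) (R₂ : Walk′ z x) (R-isPath : IsPath (R₁ ++ R₂))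
    (R-clear : ∀ {t} → t ∈ᵥ R₁ ++ R₂ → t ≡ x ⊎ ¬ t ∈θ T) (x∈θ : x ∈θ T)
    (S : Walk′ z y) (S-isPath : IsPath S) (S-avoids : ∀ {t} → t ∈ᵥ S → t ≢ x)
    (S-meets-R : ∀ {t} → t ∈ᵥ S → t ≡ z ⊎ t ∉ᵥ R₁ ++ R₂)
    (S-meets-T : ∀ {t} → t ∈ᵥ S → t ≡ y ⊎ ¬ t ∈θ T) (y∈θ : y ∈θ T) where

    R-parts = IsPath-++⁻ R₁ R₂ R-isPath

    z∉θ : ¬ z ∈θ T
    z∉θ z∈θ = [ S-avoids (start∈ S) , (λ z∉ → z∉ z∈θ) ]′ (R-clear (∈ᵥ-++⁺ˡ R₁ R₂ (end∈ R₁)))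

    Q : Walk′ x y
    Q = reverse R₂ ++ S

    ear : ThetaEar T Q
    ear = record
      { isPath = IsPath-++ (reverse R₂) S (IsPath-reverse R₂ (proj₁ (proj₂ R-parts))) S-isPath junction
      ; long = ++-long (reverse R₂) S (length-pos (reverse R₂) (S-avoids (start∈ S) ∘ sym))
                       (length-pos S (λ { refl → z∉θ y∈θ }))
      ; start∈θ = x∈θ
      ; end∈θ = y∈θ
      ; touch = touch
      }
      where
      junction : MeetAtJunction (reverse R₂) S
      junction hr hs = [ id , (λ t∉R → ⊥-elim (t∉R (∈ᵥ-++⁺ʳ R₁ R₂ (∈ᵥ-reverse⁻ R₂ hr)))) ]′ (S-meets-R hs)
      touch : ∀ {t} → t ∈ᵥ Q → t ∈θ T → t ≡ x ⊎ t ≡ y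
      touch h t∈θ with ∈ᵥ-++⁻ (reverse R₂) S h
      ... | inj₁ hr =
        inj₁ ([ id , (λ t∉θ → ⊥-elim (t∉θ t∈θ)) ]′ (R-clear (∈ᵥ-++⁺ʳ R₁ R₂ (∈ᵥ-reverse⁻ R₂ hr))))
      ... | inj₂ hs = inj₂ ([ id , (λ t∉θ → ⊥-elim (t∉θ t∈θ)) ]′ (S-meets-T hs))

    open Extension (addEar T Q ear)

    approach : Approach theta w
    approach = record
      { route = R₁
      ; isPath = proj₁ R-parts
      ; target∈θ = covers (∈ᵥ-++⁺ˡ (reverse R₂) S (end∈ (reverse R₂)))
      ; clear = clear
      }
      where
      clear : ∀ {t} → t ∈ᵥ R₁ → t ≡ z ⊎ ¬ t ∈θ theta
      clear {t} h with t ≟ᶠ z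
      ... | yes eq = inj₁ eq
      ... | no t≢z = inj₂ (λ t∈θ′ → [ off-T , off-Q ]′ (within t∈θ′))
        where
        off-R₂ : t ∉ᵥ R₂
        off-R₂ = t≢z ∘ proj₂ (proj₂ R-parts) h
        off-T : ¬ t ∈θ T
        off-T t∈θ with R-clear (∈ᵥ-++⁺ˡ R₁ R₂ h)
        ... | inj₁ refl = off-R₂ (end∈ R₂)
        ... | inj₂ t∉θ = t∉θ t∈θ
        off-Q : t ∉ᵥ Q
        off-Q hq with ∈ᵥ-++⁻ (reverse R₂) S hq
        ... | inj₁ hr = off-R₂ (∈ᵥ-reverse⁻ R₂ hr)
        ... | inj₂ hs = [ t≢z , (λ t∉R → t∉R (∈ᵥ-++⁺ˡ R₁ R₂ h)) ]′ (S-meets-R hs)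

  module _ (connect : ∀ a b → Walk′ a b)
           (avoid : ∀ {s a b} → a ≢ s → b ≢ s → Σ (Walk′ a b) λ r → ∀ {t} → t ∈ᵥ r → t ≢ s) where

    approach : (T : Theta) (w : Vertex G) → Approach T w
    approach T w = record
      { route = prefix ; isPath = proj₁ (pathParts S.isPath) ; target∈θ = hit∈K ; clear = before-clear }
      where
      module S = Shortcut (shortcut (connect w (Theta.u T)))
      open FirstHit (firstHit (_∈θ T) (_∈θ? T) S.path (zero , start∈ (Theta.path T zero)))
      open Split split

    shorten : ∀ {T w} (A : Approach T w) → 1 ≤ length (Approach.route A) →
              Σ Theta λ T′ → Σ (Approach T′ w) λ A′ →
                suc (length (Approach.route A′)) ≤ length (Approach.route A)
    shorten {T} A nontrivial = _ , D.approach , shorter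
      where
      open Approach A
      y₀ = otherVertex T target
      detour = avoid (IsPath⇒≢ route isPath nontrivial) (proj₂ (proj₂ y₀))
      module S = Shortcut (shortcut (proj₁ detour))
      h₁ = firstHit (_∈θ T) (_∈θ? T) S.path (proj₁ (proj₂ y₀))
      module S₁ = Split (FirstHit.split h₁)
      h₂ = lastHit (_∈ᵥ route) (_∈ᵥ? route) S₁.prefix (start∈ route)
      module S₂ = Split (LastHit.split h₂)
      open Split (splitAt route (LastHit.hit∈K h₂)) renaming (prefix to R₁; suffix to R₂; glue to R-glue)
      S₂ = S₂.suffix
      S₂-avoids : ∀ {t} → t ∈ᵥ S₂ → t ≢ target
      S₂-avoids = proj₂ detour ∘ S.⊆ᵥ ∘ S₁.prefix⊆ ∘ S₂.suffix⊆
      module D = Detour {T = T} R₁ R₂ (subst IsPath (sym R-glue) isPath)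
                        (clear ∘ subst (_ ∈ᵥ_) R-glue) target∈θ
                        S₂ (proj₁ (proj₂ (S₂.pathParts (proj₁ (S₁.pathParts S.isPath))))) S₂-avoids
                        (Data.Sum.map₂ (_∘ subst (_ ∈ᵥ_) R-glue) ∘ LastHit.after-clear h₂)
                        (FirstHit.before-clear h₁ ∘ S₂.suffix⊆) (FirstHit.hit∈K h₁)
      shorter : suc (length R₁) ≤ length route
      shorter = subst (suc (length R₁) ≤_) (cong length R-glue)
                      (length-<-++ R₁ R₂ (length-pos R₂ (S₂-avoids (start∈ S₂))))

    reach : ∀ n {T w} (A : Approach T w) → length (Approach.route A) ≤ n → Σ Theta (w ∈θ_)
    reach _ {T} record { route = nil ; target∈θ = w∈θ } _ = T , w∈θ
    reach (suc n) A@record { route = cons _ _ _ } (s≤s bound) with shorten A (s≤s z≤n)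
    ... | T′ , A′ , shorter = reach n A′ (≤-pred (≤-trans shorter (s≤s bound)))

    onSomeTheta : Theta → (w : Vertex G) → Σ Theta (w ∈θ_)
    onSomeTheta T w = reach _ (approach T w) ≤-refl

thirdVertex : ∀ {n} {x y z : Fin n} (a b : Fin n) → x ≢ y → x ≢ z → y ≢ z →
              ∃[ w ] (w ≡ x ⊎ w ≡ y ⊎ w ≡ z) × w ≢ a × w ≢ b
thirdVertex {x = x} {y} {z} a b x≢y x≢z y≢z with x ≟ᶠ a | x ≟ᶠ b
... | no x≢a | no x≢b = x , inj₁ refl , x≢a , x≢b
... | yes refl | _ with y ≟ᶠ b
...   | no y≢b = y , inj₂ (inj₁ refl) , x≢y ∘ sym , y≢b
...   | yes refl = z , inj₂ (inj₂ refl) , x≢z ∘ sym , y≢z ∘ sym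
thirdVertex {x = x} {y} {z} a b x≢y x≢z y≢z | no _ | yes refl with y ≟ᶠ a
...   | no y≢a = y , inj₂ (inj₁ refl) , y≢a , x≢y ∘ sym
...   | yes refl = z , inj₂ (inj₂ refl) , y≢z ∘ sym , x≢z ∘ sym

module TwoPathsIn (G : Graph) (H : Subgraph G) (tcH : TwoConnected G H) where

  open Edges G
  open Walks G
  module H = Subgraph H

  private variable
    a b t t′ : Vertex G
    e : Edge G

  record InH (w : Walk′ a b) : Set where
    field
      vertices : ∀ {s} → s ∈ᵥ w → H.V s
      edges : ∀ {f} → f ∈ₑ w → H.E f

  InH-⊆ : {w : Walk′ a b} {w′ : Walk′ t t′} → (∀ {s} → s ∈ᵥ w′ → s ∈ᵥ w) → (∀ {f} → f ∈ₑ w′ → f ∈ₑ w) →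
          InH w → InH w′
  InH-⊆ ⊆ᵥ ⊆ₑ inH = record { vertices = vertices ∘ ⊆ᵥ ; edges = edges ∘ ⊆ₑ }
    where open InH inH

  InH-++ : (p : Walk′ a b) (q : Walk′ b t) → InH p → InH q → InH (p ++ q)
  InH-++ p q inp inq = record
    { vertices = [ InH.vertices inp , InH.vertices inq ]′ ∘ ∈ᵥ-++⁻ p q
    ; edges = [ InH.edges inp , InH.edges inq ]′ ∘ ∈ₑ-++⁻ p q
    }

  InH-edge : (j : Joins G e a b) → H.E e → H.V a → H.V b → InH (cons e j nil)
  InH-edge _ he va vb = record
    { vertices = λ { (inj₁ refl) → va ; (inj₂ refl) → vb }
    ; edges = λ { (inj₁ refl) → he }
    }

  H-closed : H.E e → Joins G e a b → H.V b
  H-closed {e} he (inj₁ (_ , refl)) = proj₂ (H.closed e he)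
  H-closed {e} he (inj₂ (refl , _)) = proj₁ (H.closed e he)

  connectH : H.V a → H.V b → Σ (Walk′ a b) λ p → IsPath p × InH p
  connectH va vb = path , isPath , InH-⊆ ⊆ᵥ ⊆ₑ record
    { vertices = fromWalk-invariant H.V walk H-closed va ; edges = fromWalk-edges walk }
    where
    walk = proj₁ (proj₂ tcH) _ _ va vb
    open Shortcut (shortcut (fromWalk walk))

  avoidH : ∀ {s} → H.V a → H.V b → a ≢ s → b ≢ s →
           Σ (Walk′ a b) λ r → InH r × (∀ {t} → t ∈ᵥ r → t ≢ s)
  avoidH va vb a≢s b≢s = fromWalk walk , inH , fromWalk-avoids walk proj₂ a≢s
    where
    walk = proj₂ (proj₂ tcH) _ _ _ va vb a≢s b≢s
    inH = record { vertices = fromWalk-invariant H.V walk (H-closed ∘ proj₁) va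
                 ; edges = proj₁ ∘ fromWalk-edges walk }

  record TwoPaths (a b : Vertex G) : Set where
    field
      first second : Walk′ a b
      first-isPath : IsPath first
      second-isPath : IsPath second
      disjoint : InnerDisjoint′ first second
      first-inH : InH first
      second-inH : InH second
      ends-differ : a ≢ b

  TwoPaths-swap : TwoPaths a b → TwoPaths a b
  TwoPaths-swap P = record
    { first = second ; second = first ; first-isPath = second-isPath ; second-isPath = first-isPath
    ; disjoint = InnerDisjoint′-sym disjoint ; first-inH = second-inH ; second-inH = first-inH
    ; ends-differ = ends-differ }
    where open TwoPaths P

  LongSecond : Vertex G → Vertex G → Set
  LongSecond a b = Σ (TwoPaths a b) λ P → 2 ≤ length (TwoPaths.second P)

  -- The fan moves from t to t′: the first path is cut at the start z of the detour S and continued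
  -- along S, the second path is extended by the edge t t′.
  module Step {a t t′ z : Vertex G} {e : Edge G} (P : TwoPaths a t) (z∈ : z ∈ᵥ TwoPaths.first P)
    (S : Walk′ z t′) (iS : IsPath S) (inS : InH S)
    (S-meets : ∀ {s} → s ∈ᵥ S → s ≡ z ⊎ (s ∉ᵥ TwoPaths.first P × s ∉ᵥ TwoPaths.second P))
    (S-avoids : ∀ {s} → s ∈ᵥ S → s ≢ t) (j : Joins G e t t′) (he : H.E e) (t′≢a : t′ ≢ a) where

    open TwoPaths P
    open Split (splitAt first z∈) renaming (prefix to C₁)
    edge : Walk′ t t′
    edge = cons e j nil
    parts = pathParts first-isPath
    t∉C₁ : t ∉ᵥ C₁
    t∉C₁ h = S-avoids (start∈ S) (sym (proj₂ (proj₂ parts) h (end∈ suffix)))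
    t′∉second : t′ ∉ᵥ second
    t′∉second h with S-meets (end∈ S)
    ... | inj₂ (_ , t′∉) = t′∉ h
    ... | inj₁ eq = [ t′≢a , Joins⇒≢ j ∘ sym ]′ (disjoint (subst (_∈ᵥ first) (sym eq) z∈) h)
    i₁ : IsPath (C₁ ++ S)
    i₁ = IsPath-++ C₁ S (proj₁ parts) iS λ hc hs →
           [ id , (λ off → ⊥-elim (proj₁ off (prefix⊆ hc))) ]′ (S-meets hs)
    i₂ : IsPath (second ++ edge)
    i₂ = IsPath-++ second edge second-isPath (Joins⇒≢ j , tt) junction
      where
      junction : MeetAtJunction second edge
      junction h (inj₁ eq) = eq
      junction h (inj₂ refl) = ⊥-elim (t′∉second h)
    d : InnerDisjoint′ (C₁ ++ S) (second ++ edge)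
    d h h′ with ∈ᵥ-++⁻ C₁ S h | ∈ᵥ-++⁻ second edge h′
    ... | _ | inj₂ (inj₂ eq) = inj₂ eq
    ... | inj₁ hc | inj₂ (inj₁ refl) = ⊥-elim (t∉C₁ hc)
    ... | inj₂ hs | inj₂ (inj₁ refl) = ⊥-elim (S-avoids hs refl)
    ... | inj₁ hc | inj₁ h₂ = Data.Sum.map₂ (λ { refl → ⊥-elim (t∉C₁ hc) }) (disjoint (prefix⊆ hc) h₂)
    ... | inj₂ hs | inj₁ h₂ with S-meets hs
    ...   | inj₂ (_ , off) = ⊥-elim (off h₂)
    ...   | inj₁ refl = Data.Sum.map₂ (λ eq → ⊥-elim (S-avoids hs eq)) (disjoint z∈ h₂)

    moved : LongSecond a t′
    moved =
      record
        { first = C₁ ++ S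
        ; second = second ++ edge
        ; first-isPath = i₁
        ; second-isPath = i₂
        ; disjoint = d
        ; first-inH = InH-++ C₁ S (InH-⊆ prefix⊆ prefix⊆ₑ first-inH) inS
        ; second-inH = InH-++ second edge second-inH
                         (InH-edge j he (InH.vertices second-inH (end∈ second)) (InH.vertices inS (end∈ S)))
        ; ends-differ = t′≢a ∘ sym
        }
      , ++-long second edge (length-pos second ends-differ) (s≤s z≤n)

  step : TwoPaths a t → (j : Joins G e t t′) → H.E e → H.V t′ → t′ ≢ a → LongSecond a t′
  step {a = a} {t = t} {t′ = t′} P j he vt′ t′≢a = fromHit hit∈K
    where
    open TwoPaths P
    detour = avoidH (InH.vertices first-inH (start∈ first)) vt′ ends-differ (Joins⇒≢ j ∘ sym)
    module S = Shortcut (shortcut (proj₁ detour))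
    OnFan : Vertex G → Set
    OnFan s = s ∈ᵥ first ⊎ s ∈ᵥ second
    open LastHit (lastHit OnFan (λ s → (s ∈ᵥ? first) ⊎-dec (s ∈ᵥ? second)) S.path (inj₁ (start∈ first)))
    open Split split
    S′-isPath : IsPath suffix
    S′-isPath = proj₁ (proj₂ (pathParts S.isPath))
    S′-inH : InH suffix
    S′-inH = InH-⊆ (S.⊆ᵥ ∘ suffix⊆) (S.⊆ₑ ∘ suffix⊆ₑ) (proj₁ (proj₂ detour))
    S′-avoids : ∀ {s} → s ∈ᵥ suffix → s ≢ t
    S′-avoids = proj₂ (proj₂ detour) ∘ S.⊆ᵥ ∘ suffix⊆
    S′-meets : ∀ {s} → s ∈ᵥ suffix → s ≡ hit ⊎ (s ∉ᵥ first × s ∉ᵥ second)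
    S′-meets = Data.Sum.map₂ (λ off → off ∘ inj₁ , off ∘ inj₂) ∘ after-clear
    fromHit : OnFan hit → LongSecond a t′
    fromHit (inj₁ h) = Step.moved P h suffix S′-isPath S′-inH S′-meets S′-avoids j he t′≢a
    fromHit (inj₂ h) = Step.moved (TwoPaths-swap P) h suffix S′-isPath S′-inH
                               (Data.Sum.map₂ Data.Product.swap ∘ S′-meets) S′-avoids j he t′≢a

  extendAlong : ∀ {b} → TwoPaths a t → (j : Joins G e t t′) (Q : Walk′ t′ b) → InH (cons e j Q) →
                (∀ {s} → s ∈ᵥ Q → s ≢ a) → LongSecond a b
  extendAlong P j nil inH avoids-a =
    step P j (InH.edges inH (inj₁ refl)) (InH.vertices inH (inj₂ refl)) (avoids-a refl)
  extendAlong P j (cons e′ j′ Q) inH avoids-a =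
    extendAlong (proj₁ (step P j (InH.edges inH (inj₁ refl)) (InH.vertices inH (inj₂ (inj₁ refl)))
                             (avoids-a (inj₁ refl))))
                j′ Q (InH-⊆ inj₂ inj₂ inH) (avoids-a ∘ inj₂)

  vertexBesides : ∀ a b → ∃[ c ] H.V c × c ≢ a × c ≢ b
  vertexBesides a b with proj₁ tcH
  ... | x , y , z , vx , vy , vz , x≢y , x≢z , y≢z with thirdVertex a b x≢y x≢z y≢z
  ...   | c , which , c≢a , c≢b =
    c , [ (λ { refl → vx }) , [ (λ { refl → vy }) , (λ { refl → vz }) ]′ ]′ which , c≢a , c≢b

  EdgeDisjointPaths : Vertex G → Vertex G → Set
  EdgeDisjointPaths a b = Σ (TwoPaths a b) λ P → EdgeDisjoint′ (TwoPaths.first P) (TwoPaths.second P)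

  -- When a b is an edge of H, a third vertex of H yields an a–b path of H avoiding that edge.
  aroundEdge : (j : Joins G e a b) → H.E e → H.V a → H.V b → EdgeDisjointPaths a b
  aroundEdge {e = e} {a = a} {b = b} j he va vb =
    record
      { first = path
      ; second = edge
      ; first-isPath = isPath
      ; second-isPath = a≢b , tt
      ; disjoint = λ _ h → h
      ; first-inH = InH-⊆ ⊆ᵥ ⊆ₑ (InH-++ r₁ r₂ (proj₁ (proj₂ walk₁)) (proj₁ (proj₂ walk₂)))
      ; second-inH = InH-edge j he va vb
      ; ends-differ = a≢b
      }
    , e∉
    where
    a≢b = Joins⇒≢ j
    edge : Walk′ a b
    edge = cons e j nil
    c = vertexBesides a b
    walk₁ = avoidH va (proj₁ (proj₂ c)) a≢b (proj₂ (proj₂ (proj₂ c)))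
    walk₂ = avoidH (proj₁ (proj₂ c)) vb (proj₁ (proj₂ (proj₂ c))) (a≢b ∘ sym)
    r₁ = proj₁ walk₁
    r₂ = proj₁ walk₂
    open Shortcut (shortcut (r₁ ++ r₂))
    e∉ : EdgeDisjoint′ path edge
    e∉ hp (inj₁ refl) with ∈ₑ-++⁻ r₁ r₂ (⊆ₑ hp)
    ... | inj₁ h₁ = proj₂ (proj₂ walk₁) (∈ₑ⇒ends∈ᵥ r₁ h₁ (Joins⇒Incidentʳ j)) refl
    ... | inj₂ h₂ = proj₂ (proj₂ walk₂) (∈ₑ⇒ends∈ᵥ r₂ h₂ (Joins⇒Incidentˡ j)) refl

  twoPaths : H.V a → H.V b → a ≢ b → EdgeDisjointPaths a b
  twoPaths va vb a≢b with connectH va vb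
  ... | nil , _ = ⊥-elim (a≢b refl)
  ... | cons e j nil , _ , inH = aroundEdge j (InH.edges inH (inj₁ refl)) va vb
  ... | cons e j (cons e′ j′ Q) , (a∉ , _) , inH =
    P , EdgeDisjoint′-sym (InnerDisjoint′⇒EdgeDisjoint′ second first second-isPath long (InnerDisjoint′-sym disjoint))
    where
    edge = cons e j nil
    start : TwoPaths _ _
    start = record
      { first = edge ; second = edge ; first-isPath = Joins⇒≢ j , tt ; second-isPath = Joins⇒≢ j , tt
      ; disjoint = λ h _ → h ; first-inH = InH-⊆ (Data.Sum.map₂ inj₁) (Data.Sum.map₂ ⊥-elim) inH
      ; second-inH = InH-⊆ (Data.Sum.map₂ inj₁) (Data.Sum.map₂ ⊥-elim) inH ; ends-differ = Joins⇒≢ j }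
    extended = extendAlong start j′ Q (InH-⊆ inj₂ inj₂ inH) (λ h eq → a∉ (inj₂ (subst (_∈ᵥ Q) eq h)))
    P = proj₁ extended
    long = proj₂ extended
    open TwoPaths P

module OddThetas (G : Graph) (colour : Vertex G → Bool) (proper : ∀ e → colour (src G e) ≢ colour (tgt G e)) where

  open Walks G
  open Parity G colour proper
  open Thetas G colour proper

  earTheta : (H : Subgraph G) → TwoConnected G H → (P : Path G) → Ear G H P → OddPath G P → Theta
  earTheta H tcH P (va , vb , a≢b , inner∉H , edges∉H) odd =
    mkTheta differ ear first second ear-isPath first-isPath second-isPath
            (off-H first-inH) (off-H second-inH) disjoint
            (edges-off-H first-inH) (edges-off-H second-inH) edgeDisjoint
    where
    open Path P
    open TwoPathsIn G H tcH
    ear : Walk′ start end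
    ear = walkThrough (suc len) vtx edge joins
    ear-isPath : IsPath ear
    ear-isPath = walkThrough-isPath (suc len) vtx edge joins vtx-inj
    differ : colour start ≢ colour end
    differ = odd⇒colours-differ ear (subst Odd (sym (walkThrough-length (suc len) vtx edge joins)) odd)
    open Σ (twoPaths va vb a≢b) renaming (proj₁ to paths; proj₂ to edgeDisjoint)
    open TwoPaths paths
    off-H : {q : Walk′ start end} → InH q → InnerDisjoint′ ear q
    off-H inq {t} he hq with t ≟ᶠ start | t ≟ᶠ end
    ... | yes eq | _ = inj₁ eq
    ... | no _ | yes eq = inj₂ eq
    ... | no t≢a | no t≢b =
      ⊥-elim (inner∉H t (walkThrough-∈ᵥ (suc len) vtx edge joins he , t≢a , t≢b) (InH.vertices inq hq))
    edges-off-H : {q : Walk′ start end} → InH q → EdgeDisjoint′ ear q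
    edges-off-H inq he hq with walkThrough-∈ₑ (suc len) vtx edge joins he
    ... | i , refl = edges∉H i (InH.edges inq hq)

  toOddTheta : (T : Theta) → Σ (OddTheta G) λ O → ∀ {t} → t ∈θ T → InTheta G O t
  toOddTheta T = O , covers
    where
    open Theta T
    open Traces
    P : Fin 3 → Path G
    P i = proj₁ (toPath (path i) (isPath i) u≢v)
    traces : ∀ i → Traces (P i) (path i)
    traces i = proj₂ (toPath (path i) (isPath i) u≢v)
    inner : ∀ i k → i ≢ k → InnerDisjoint G (P i) (P k)
    inner i k i≢k t oi ok =
      Data.Sum.map (λ eq → trans eq (sym (start≡ (traces i)))) (λ eq → trans eq (sym (end≡ (traces i))))
                   (innerDisjoint i k i≢k (on⁻ (traces i) oi) (on⁻ (traces k) ok))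
    edges : ∀ i k → i ≢ k → EdgeDisjoint G (P i) (P k)
    edges i k i≢k a b eq = edgeDisjoint i k i≢k (edge∈ (traces i) a) (subst (_∈ₑ path k) (sym eq) (edge∈ (traces k) b))
    odd : ∀ i → OddPath G (P i)
    odd i = subst Odd (sym (numEdges≡ (traces i))) (proj₂ (walk-parity (path i)) colours-differ)
    O : OddTheta G
    O = record
      { u = u ; v = v ; P₁ = P zero ; P₂ = P (suc zero) ; P₃ = P (suc (suc zero))
      ; s₁ = start≡ (traces zero) ; s₂ = start≡ (traces (suc zero)) ; s₃ = start≡ (traces (suc (suc zero)))
      ; e₁ = end≡ (traces zero) ; e₂ = end≡ (traces (suc zero)) ; e₃ = end≡ (traces (suc (suc zero)))
      ; odd₁ = odd zero ; odd₂ = odd (suc zero) ; odd₃ = odd (suc (suc zero))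
      ; id₁₂ = inner zero (suc zero) (λ ()) ; id₁₃ = inner zero (suc (suc zero)) (λ ())
      ; id₂₃ = inner (suc zero) (suc (suc zero)) (λ ())
      ; ed₁₂ = edges zero (suc zero) (λ ()) ; ed₁₃ = edges zero (suc (suc zero)) (λ ())
      ; ed₂₃ = edges (suc zero) (suc (suc zero)) (λ ())
      }
    covers : ∀ {t} → t ∈θ T → InTheta G O t
    covers (zero , h) = inj₁ (on⁺ (traces zero) h)
    covers (suc zero , h) = inj₂ (inj₁ (on⁺ (traces (suc zero)) h))
    covers (suc (suc zero) , h) = inj₂ (inj₂ (on⁺ (traces (suc (suc zero))) h))

propositionA2 : (G : Graph) → Bipartite G → TwoConnected G (whole G)
    → (H : Subgraph G) → TwoConnected G H
    → (P : Path G) → Ear G H P → OddPath G P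
    → (w : Vertex G) → Σ (OddTheta G) (λ T → InTheta G T w)
propositionA2 G (colour , proper) (_ , connected , separated) H tcH P ear odd w =
  proj₁ (toOddTheta T) , proj₂ (toOddTheta T) w∈T
  where
  open Walks G
  open Thetas G colour proper
  open OddThetas G colour proper
  connect : ∀ a b → Walk′ a b
  connect a b = fromWalk (connected a b tt tt)
  avoid : ∀ {s a b} → a ≢ s → b ≢ s → Σ (Walk′ a b) λ r → ∀ {t} → t ∈ᵥ r → t ≢ s
  avoid a≢s b≢s = fromWalk walk , fromWalk-avoids walk proj₂ a≢s
    where walk = separated _ _ _ tt tt a≢s b≢s
  reached = onSomeTheta connect avoid (earTheta H tcH P ear odd) w
  T = proj₁ reached
  w∈T = proj₂ reached
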